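{- Let $P$ be a polygon with vertex set $V$ and let $D$ be a polygon dissection of $P$ into subpolygons $P_1,\ldots,P_s$ with vertex sets $V_1,\ldots,V_s$. For each $i$ let $f_i$ be a frieze on $P_i$, and let $f$ be the unique frieze on $P$ restricting to $f_i$ on $V_i\times V_i$ for each $i$. Suppose there are numbers $c_1,\ldots,c_s$ such that for each $i$, whenever $\alpha',\alpha,\alpha''$ are consecutive vertices of $P_i$ (in its cyclic order), $f_i(\alpha',\alpha'')=c_i$. Then for each $\alpha\in V$, $$f(\alpha^-,\alpha^+)=\sum_{P_i \text{ incident with } \alpha} c_i .$$
   Context: A polygon is a finite set $V$ of at least three vertices with a cyclic ordering; $\alpha^-,\alpha^+$ denote predecessor and successor. A diagonal is a pair $\{\alpha,\beta\}\subset V$ with $\beta\notin\{\alpha^-,\alpha,\alpha^+\}$; diagonals $\{\alpha,\beta\}$ and $\{\gamma,\delta\}$ cross if $\alpha,\beta,\gamma,\delta$ are distinct and appear in cyclic order $\alpha,\gamma,\beta,\delta$ or $\alpha,\delta,\beta,\gamma$. A polygon dissection is a set of pairwise non-crossing diagonals; it splits $P$ into subpolygons with induced cyclic orders; $P_i$ is incident with $\alpha$ if $\alpha\in V_i$. A frieze on a polygon with vertex set $V$ is a map $f: V\times V \to [0,\infty)$ such that (i) $f(\alpha,\beta)=0$ iff $\alpha=\beta$; (ii) $f(\alpha,\alpha^+)=1$; (iii) $f(\alpha,\beta)=f(\beta,\alpha)$; (iv) for crossing diagonals $\{\alpha,\beta\},\{\gamma,\delta\}$, $f(\alpha,\beta)f(\gamma,\delta)=f(\alpha,\gamma)f(\beta,\delta)+f(\alpha,\delta)f(\gamma,\beta)$.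 Given friezes on the subpolygons of a dissection, there is a unique frieze on $P$ restricting to each of them. -}

module Defs where

open import Level using (Level; _⊔_) renaming (suc to lsuc)
open import Data.Nat using (ℕ; zero; suc) renaming (_≤_ to _≤ℕ_)
open import Data.Fin using (Fin; _<_)
open import Data.Fin.Subset using (Subset; _∈_; ⊤; ∣_∣)
open import Data.Vec using (lookup)
open import Data.Bool using (if_then_else_)
open import Data.List using (List)
open import Data.List.Membership.Propositional using () renaming (_∈_ to _∈L_)
open import Data.Product using (Σ; ∃; _×_; _,_; proj₁; proj₂)
open import Data.Sum using (_⊎_)
open import Relation.Nullary using (¬_)
open import Relation.Binary.PropositionalEquality using (_≡_; _≢_)
open import Relation.Binary.Structures using (IsTotalOrder)
open import Algebra.Bundles using (CommutativeRing)
open import Function.Bundles using (_⇔_)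

-- The real numbers, as an arbitrary complete ordered field
-- (ℝ is the unique complete ordered field up to isomorphism).

record CompleteOrderedField (c ℓ₁ ℓ₂ : Level) : Set (lsuc (c ⊔ ℓ₁ ⊔ ℓ₂)) where
  field
    commutativeRing : CommutativeRing c ℓ₁
  open CommutativeRing commutativeRing public
  field
    _≤_          : Carrier → Carrier → Set ℓ₂
    isTotalOrder : IsTotalOrder _≈_ _≤_
    1≉0          : ¬ (1# ≈ 0#)
    inverse      : ∀ x → ¬ (x ≈ 0#) → ∃ λ y → x * y ≈ 1#
    +-mono-≤     : ∀ {x y} z → x ≤ y → (x + z) ≤ (y + z)
    *-nonneg     : ∀ {x y} → 0# ≤ x → 0# ≤ y → 0# ≤ (x * y)
    complete     : (S : Carrier → Set ℓ₂) → (∃ λ x → S x) →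
                   (∃ λ b → ∀ x → S x → x ≤ b) →
                   ∃ λ u → (∀ x → S x → x ≤ u) × (∀ b → (∀ x → S x → x ≤ b) → u ≤ b)

-- Polygons: the vertex set is Fin n with cyclic order 0,1,…,n-1,0.

Cyc : ∀ {n} → Fin n → Fin n → Fin n → Set
Cyc a b c = (a < b × b < c) ⊎ (b < c × c < a) ⊎ (c < a × a < b)

Cyc4 : ∀ {n} → Fin n → Fin n → Fin n → Fin n → Set
Cyc4 a b c d = Cyc a b c × Cyc a c d

Cross : ∀ {n} → Fin n → Fin n → Fin n → Fin n → Set
Cross a b c d = Cyc4 a c b d ⊎ Cyc4 a d b c

-- b is the successor of a in the subpolygon with vertex set W
-- (with the cyclic order induced from Fin n).
Consec : ∀ {n} → Subset n → Fin n → Fin n → Set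
Consec W a b = a ∈ W × b ∈ W × a ≢ b × (∀ x → x ∈ W → ¬ Cyc a x b)

IsDiagonal : ∀ {n} → Fin n → Fin n → Set
IsDiagonal a b = a ≢ b × ¬ Consec ⊤ a b × ¬ Consec ⊤ b a

InD : ∀ {n} → List (Fin n × Fin n) → Fin n → Fin n → Set
InD D a b = ((a , b) ∈L D) ⊎ ((b , a) ∈L D)

IsDissection : ∀ {n} → List (Fin n × Fin n) → Set
IsDissection D =
  (∀ p → p ∈L D → IsDiagonal (proj₁ p) (proj₂ p)) ×
  (∀ p q → p ∈L D → q ∈L D → ¬ Cross (proj₁ p) (proj₂ p) (proj₁ q) (proj₂ q))

-- W is the vertex set of one of the subpolygons into which D splits P:
-- at least 3 vertices, every side of W is a side of P or a diagonal of D,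
-- and every diagonal of D with both ends in W is a side of W.
IsSubpolygon : ∀ {n} → List (Fin n × Fin n) → Subset n → Set
IsSubpolygon D W =
  3 ≤ℕ ∣ W ∣ ×
  (∀ a b → Consec W a b → Consec ⊤ a b ⊎ InD D a b) ×
  (∀ a b → InD D a b → a ∈ W → b ∈ W → Consec W a b ⊎ Consec W b a)

Enumerates : ∀ {n s} → List (Fin n × Fin n) → (Fin s → Subset n) → Set
Enumerates D Ws =
  (∀ i → IsSubpolygon D (Ws i)) ×
  (∀ i j → Ws i ≡ Ws j → i ≡ j) ×
  (∀ W → IsSubpolygon D W → ∃ λ i → Ws i ≡ W)

-- Friezes (on the subpolygon with vertex set W; only values on W × W matter)

module _ {c ℓ₁ ℓ₂} (R : CompleteOrderedField c ℓ₁ ℓ₂) where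
  open CompleteOrderedField R

  record IsFrieze {n} (W : Subset n) (f : Fin n → Fin n → Carrier) : Set (c ⊔ ℓ₁ ⊔ ℓ₂) where
    field
      nonneg  : ∀ a b → a ∈ W → b ∈ W → 0# ≤ f a b
      zero⇔   : ∀ a b → a ∈ W → b ∈ W → (f a b ≈ 0#) ⇔ (a ≡ b)
      side    : ∀ a b → Consec W a b → f a b ≈ 1#
      symm    : ∀ a b → a ∈ W → b ∈ W → f a b ≈ f b a
      ptolemy : ∀ a b c d → a ∈ W → b ∈ W → c ∈ W → d ∈ W → Cross a b c d →
                f a b * f c d ≈ f a c * f b d + f a d * f c b

  sumFin : ∀ {s} → (Fin s → Carrier) → Carrier
  sumFin {zero}  g = 0#
  sumFin {suc s} g = g Fin.zero + sumFin (λ i → g (Fin.suc i))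

  incidentSum : ∀ {n s} → (Fin s → Subset n) → (Fin s → Carrier) → Fin n → Carrier
  incidentSum Ws cs a = sumFin (λ i → if lookup (Ws i) a then cs i else 0#)

module Submission where

open import Defs
open import Data.Nat using (ℕ; _≤_)
open import Data.Fin using (Fin)
open import Data.Fin.Subset using (Subset; _∈_; ⊤)
open import Data.List using (List)
open import Data.Product using (_×_)

import Data.Nat as ℕ
import Data.Fin as Fin
open import Data.Fin.Properties using (_≟_)
open import Data.Fin.Subset.Properties using (∈⊤)
open import Relation.Binary.PropositionalEquality as ≡ using (_≡_)
open import Algebra.Bundles using (CommutativeMonoid)
import Algebra.Properties.CommutativeMonoid.Sum
import Algebra.Properties.Group
import Relation.Binary.Reasoning.Setoid

-- Put h(x) = f(a⁺,x).  In a subpolygon Pᵢ containing a, let a be followed by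
-- qᵢ and preceded by pᵢ.  Ptolemy's relation for the crossing diagonals a—qᵢ and a⁺—pᵢ
-- of P, with f(a,qᵢ) = f(a,pᵢ) = 1 and f(qᵢ,pᵢ) = cᵢ, gives cᵢ = h(pᵢ) - h(qᵢ).  Seen from a,
-- the subpolygons incident with a are the wedges between consecutive vertices of the fan
-- a⁺ = m₀ ≺ m₁ ≺ … ≺ mₖ = a⁻ (the vertices joined to a by a side or a diagonal); so the
-- sum of the cᵢ telescopes to h(a⁻) - h(a⁺) = f(a⁻,a⁺) - 0.  Rather than listing the fan,
-- the telescoping is done by exchanging summations: every fan vertex x ≠ a⁺ precedes a
-- in exactly one Pᵢ, every fan vertex x ≠ a⁻ follows a in exactly one Pᵢ, and no other
-- vertex is a neighbour of a in any Pᵢ.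

module CyclicOrder {n : ℕ} where
  open import Data.Fin using (_<_)
  open import Data.Fin.Properties using (_<?_; <-cmp; <-trans; <-asym)
  open import Data.Product using (_,_)
  open import Data.Sum using (_⊎_; inj₁; inj₂)
  open import Data.Empty using (⊥-elim)
  open import Relation.Nullary using (¬_; Dec)
  open import Relation.Nullary.Decidable using (_×-dec_; _⊎-dec_)
  open import Relation.Binary.PropositionalEquality using (_≢_; sym)
  open import Relation.Binary.Definitions using (tri<; tri≈; tri>)

  private
    variable
      a x y z : Fin n

    <-no-wrap : x < y → y < z → ¬ z < x
    <-no-wrap p q r = <-asym (<-trans p q) r

  Cyc-rotate : Cyc x y z → Cyc y z x
  Cyc-rotate (inj₁ p)        = inj₂ (inj₂ p)
  Cyc-rotate (inj₂ (inj₁ p)) = inj₁ p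
  Cyc-rotate (inj₂ (inj₂ p)) = inj₂ (inj₁ p)

  Cyc? : (x y z : Fin n) → Dec (Cyc x y z)
  Cyc? x y z = ((x <? y) ×-dec (y <? z)) ⊎-dec ((y <? z) ×-dec (z <? x)) ⊎-dec ((z <? x) ×-dec (x <? y))

  Cyc-trans : Cyc a x y → Cyc a y z → Cyc a x z
  Cyc-trans (inj₁ (ax , xy))        (inj₁ (ay , yz))        = inj₁ (ax , <-trans xy yz)
  Cyc-trans (inj₁ (ax , xy))        (inj₂ (inj₁ (yz , za))) = ⊥-elim (<-no-wrap (<-trans ax xy) yz za)
  Cyc-trans (inj₁ (ax , xy))        (inj₂ (inj₂ (za , ay))) = inj₂ (inj₂ (za , ax))
  Cyc-trans (inj₂ (inj₁ (xy , ya))) (inj₁ (ay , yz))        = ⊥-elim (<-asym ya ay)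
  Cyc-trans (inj₂ (inj₁ (xy , ya))) (inj₂ (inj₁ (yz , za))) = inj₂ (inj₁ (<-trans xy yz , za))
  Cyc-trans (inj₂ (inj₁ (xy , ya))) (inj₂ (inj₂ (za , ay))) = ⊥-elim (<-asym ya ay)
  Cyc-trans (inj₂ (inj₂ (ya , ax))) (inj₁ (ay , yz))        = ⊥-elim (<-asym ya ay)
  Cyc-trans (inj₂ (inj₂ (ya , ax))) (inj₂ (inj₁ (yz , za))) = inj₂ (inj₂ (za , ax))
  Cyc-trans (inj₂ (inj₂ (ya , ax))) (inj₂ (inj₂ (za , ay))) = ⊥-elim (<-asym ya ay)

  Cyc-between : Cyc a x y → Cyc a y z → Cyc x y z
  Cyc-between (inj₁ (ax , xy))        (inj₁ (ay , yz))        = inj₁ (xy , yz)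
  Cyc-between (inj₁ (ax , xy))        (inj₂ (inj₁ (yz , za))) = ⊥-elim (<-no-wrap (<-trans ax xy) yz za)
  Cyc-between (inj₁ (ax , xy))        (inj₂ (inj₂ (za , ay))) = inj₂ (inj₂ (<-trans za ax , xy))
  Cyc-between (inj₂ (inj₁ (xy , ya))) (inj₁ (ay , yz))        = ⊥-elim (<-asym ya ay)
  Cyc-between (inj₂ (inj₁ (xy , ya))) (inj₂ (inj₁ (yz , za))) = inj₁ (xy , yz)
  Cyc-between (inj₂ (inj₁ (xy , ya))) (inj₂ (inj₂ (za , ay))) = ⊥-elim (<-asym ya ay)
  Cyc-between (inj₂ (inj₂ (ya , ax))) (inj₁ (ay , yz))        = ⊥-elim (<-asym ya ay)
  Cyc-between (inj₂ (inj₂ (ya , ax))) (inj₂ (inj₁ (yz , za))) = inj₂ (inj₁ (yz , <-trans za ax))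
  Cyc-between (inj₂ (inj₂ (ya , ax))) (inj₂ (inj₂ (za , ay))) = ⊥-elim (<-asym ya ay)

  Cyc-asym : Cyc x y z → ¬ Cyc x z y
  Cyc-asym (inj₁ (xy , yz))        (inj₁ (xz , zy))        = <-asym yz zy
  Cyc-asym (inj₁ (xy , yz))        (inj₂ (inj₁ (zy , yx))) = <-asym yz zy
  Cyc-asym (inj₁ (xy , yz))        (inj₂ (inj₂ (yx , xz))) = <-asym xy yx
  Cyc-asym (inj₂ (inj₁ (yz , zx))) (inj₁ (xz , zy))        = <-asym yz zy
  Cyc-asym (inj₂ (inj₁ (yz , zx))) (inj₂ (inj₁ (zy , yx))) = <-asym yz zy
  Cyc-asym (inj₂ (inj₁ (yz , zx))) (inj₂ (inj₂ (yx , xz))) = <-asym zx xz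
  Cyc-asym (inj₂ (inj₂ (zx , xy))) (inj₁ (xz , zy))        = <-asym zx xz
  Cyc-asym (inj₂ (inj₂ (zx , xy))) (inj₂ (inj₁ (zy , yx))) = <-asym xy yx
  Cyc-asym (inj₂ (inj₂ (zx , xy))) (inj₂ (inj₂ (yx , xz))) = <-asym zx xz

  Cyc-total : x ≢ y → x ≢ a → y ≢ a → Cyc a x y ⊎ Cyc a y x
  Cyc-total {x} {y} {a} x≢y x≢a y≢a with <-cmp a x | <-cmp a y | <-cmp x y
  ... | tri≈ _ e _ | _          | _          = ⊥-elim (x≢a (sym e))
  ... | _          | tri≈ _ e _ | _          = ⊥-elim (y≢a (sym e))
  ... | _          | _          | tri≈ _ e _ = ⊥-elim (x≢y e)
  ... | tri< ax _ _ | tri< ay _ _ | tri< xy _ _ = inj₁ (inj₁ (ax , xy))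
  ... | tri< ax _ _ | tri< ay _ _ | tri> _ _ yx = inj₂ (inj₁ (ay , yx))
  ... | tri< ax _ _ | tri> _ _ ya | _           = inj₁ (inj₂ (inj₂ (ya , ax)))
  ... | tri> _ _ xa | tri< ay _ _ | _           = inj₂ (inj₂ (inj₂ (xa , ay)))
  ... | tri> _ _ xa | tri> _ _ ya | tri< xy _ _ = inj₁ (inj₂ (inj₁ (xy , ya)))
  ... | tri> _ _ xa | tri> _ _ ya | tri> _ _ yx = inj₂ (inj₂ (inj₁ (yx , xa)))

  Cyc-irreflʳ : ¬ Cyc x y y
  Cyc-irreflʳ c = Cyc-asym c c

  Cyc-irreflˡ : ¬ Cyc x x z
  Cyc-irreflˡ c = Cyc-asym (Cyc-rotate c) c

  Cyc-irrefl-ends : ¬ Cyc x y x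
  Cyc-irrefl-ends c = Cyc-irreflʳ (Cyc-rotate c)

module FiniteSets where
  open import Data.Nat as ℕ using (suc; z≤n; s≤s)
  import Data.Nat.Properties as ℕ
  open import Data.Bool using (true; false)
  open import Data.Vec using (_∷_; [])
  open import Data.Fin.Properties using (_≟_; any?; all?)
  open import Data.Fin.Subset using (∣_∣; _∪_; ⁅_⁆; _-_)
  open import Data.Fin.Subset.Properties
    using (x∈p⇒∣p-x∣<∣p∣; x∈p∧x∉q⇒x∈p─q; x≢y⇒x∉⁅y⁆; x∈⁅x⁆; x∈p∪q⁺; p⊆q⇒∣p∣≤∣q∣; ∣⁅x⁆∣≡1)
    renaming (_∈?_ to _∈ˢ?_)
  import Data.List as List
  open import Data.List.Relation.Unary.Any using (here; there)
  open import Data.List.Membership.Propositional using () renaming (_∈_ to _∈ˡ_)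
  open import Data.List.Membership.Propositional.Properties using (∈-allFin)
  import Data.List.Membership.DecPropositional as DecMembership
  open import Data.Product using (∃; _,_)
  open import Data.Product.Properties using (≡-dec)
  open import Data.Sum using (_⊎_; inj₁; inj₂)
  open import Data.Empty using (⊥-elim)
  open import Relation.Nullary using (¬_; Dec; yes; no)
  open import Relation.Nullary.Decidable using (_×-dec_; _⊎-dec_; _→-dec_; ¬?)
  open import Relation.Binary.PropositionalEquality using (_≡_; _≢_; refl; sym)
  open CyclicOrder using (Cyc?)

  ∣p∪q∣≤∣p∣+∣q∣ : ∀ {n} (p q : Subset n) → ∣ p ∪ q ∣ ℕ.≤ ∣ p ∣ ℕ.+ ∣ q ∣
  ∣p∪q∣≤∣p∣+∣q∣ []          []          = z≤n
  ∣p∪q∣≤∣p∣+∣q∣ (true ∷ p)  (true ∷ q)  = s≤s (ℕ.≤-trans (∣p∪q∣≤∣p∣+∣q∣ p q) (ℕ.+-monoʳ-≤ ∣ p ∣ (ℕ.n≤1+n _)))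
  ∣p∪q∣≤∣p∣+∣q∣ (true ∷ p)  (false ∷ q) = s≤s (∣p∪q∣≤∣p∣+∣q∣ p q)
  ∣p∪q∣≤∣p∣+∣q∣ (false ∷ p) (true ∷ q)  rewrite ℕ.+-suc ∣ p ∣ ∣ q ∣ = s≤s (∣p∪q∣≤∣p∣+∣q∣ p q)
  ∣p∪q∣≤∣p∣+∣q∣ (false ∷ p) (false ∷ q) = ∣p∪q∣≤∣p∣+∣q∣ p q

  module _ {n : ℕ} where
    private
      variable
        W : Subset n
        x y z : Fin n

    three-members : x ∈ W → y ∈ W → z ∈ W → x ≢ y → x ≢ z → y ≢ z → 3 ≤ ∣ W ∣
    three-members {x} {W} {y} {z} xW yW zW x≢y x≢z y≢z =
      ℕ.≤-trans (s≤s (ℕ.≤-trans (s≤s ∣W-x-y∣≥1) ∣W-x-y∣<∣W-x∣)) ∣W-x∣<∣W∣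
      where
      y∈W-x : y ∈ W - x
      y∈W-x = x∈p∧x∉q⇒x∈p─q yW (x≢y⇒x∉⁅y⁆ (λ e → x≢y (sym e)))
      z∈W-x-y : z ∈ W - x - y
      z∈W-x-y = x∈p∧x∉q⇒x∈p─q (x∈p∧x∉q⇒x∈p─q zW (x≢y⇒x∉⁅y⁆ (λ e → x≢z (sym e))))
                               (x≢y⇒x∉⁅y⁆ (λ e → y≢z (sym e)))
      ∣W-x-y∣≥1 : 1 ≤ ∣ W - x - y ∣
      ∣W-x-y∣≥1 = ℕ.≤-trans (s≤s z≤n) (x∈p⇒∣p-x∣<∣p∣ z∈W-x-y)
      ∣W-x-y∣<∣W-x∣ : suc ∣ W - x - y ∣ ≤ ∣ W - x ∣
      ∣W-x-y∣<∣W-x∣ = x∈p⇒∣p-x∣<∣p∣ y∈W-x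
      ∣W-x∣<∣W∣ : suc ∣ W - x ∣ ≤ ∣ W ∣
      ∣W-x∣<∣W∣ = x∈p⇒∣p-x∣<∣p∣ xW

    member-avoiding : 3 ≤ ∣ W ∣ → (x y : Fin n) → ∃ λ z → z ∈ W × z ≢ x × z ≢ y
    member-avoiding {W} ∣W∣≥3 x y with any? (λ z → (z ∈ˢ? W) ×-dec ¬? (z ≟ x) ×-dec ¬? (z ≟ y))
    ... | yes found = found
    ... | no none = ⊥-elim (ℕ.<-irrefl refl
          (ℕ.≤-trans ∣W∣≥3 (ℕ.≤-trans (p⊆q⇒∣p∣≤∣q∣ W⊆xy) (ℕ.≤-trans (∣p∪q∣≤∣p∣+∣q∣ ⁅ x ⁆ ⁅ y ⁆) ∣xy∣≤2))))
      where
      ∣xy∣≤2 : ∣ ⁅ x ⁆ ∣ ℕ.+ ∣ ⁅ y ⁆ ∣ ≤ 2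
      ∣xy∣≤2 rewrite ∣⁅x⁆∣≡1 x | ∣⁅x⁆∣≡1 y = ℕ.≤-refl
      W⊆xy : ∀ {z} → z ∈ W → z ∈ ⁅ x ⁆ ∪ ⁅ y ⁆
      W⊆xy {z} zW with z ≟ x | z ≟ y
      ... | yes refl | _        = x∈p∪q⁺ (inj₁ (x∈⁅x⁆ z))
      ... | no _     | yes refl = x∈p∪q⁺ {p = ⁅ x ⁆} (inj₂ (x∈⁅x⁆ z))
      ... | no z≢x   | no z≢y   = ⊥-elim (none (z , zW , z≢x , z≢y))

    minimal : (_⊏_ : Fin n → Fin n → Set) → (∀ x y → Dec (x ⊏ y)) →
              (∀ {x y z} → x ⊏ y → y ⊏ z → x ⊏ z) → (∀ {x} → ¬ x ⊏ x) →
              (S : Fin n → Set) → (∀ x → Dec (S x)) →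
              ∃ S → ∃ λ m → S m × ∀ z → S z → ¬ z ⊏ m
    minimal _⊏_ _⊏?_ ⊏-trans ⊏-irrefl S S? (z₀ , Sz₀) with minimalIn (List.allFin n)
      where
      minimalIn : (L : List (Fin n)) →
                  (∀ z → z ∈ˡ L → ¬ S z) ⊎ (∃ λ m → S m × ∀ z → z ∈ˡ L → S z → ¬ z ⊏ m)
      minimalIn List.[] = inj₁ (λ z ())
      minimalIn (x List.∷ L) with S? x | minimalIn L
      ... | no ¬Sx | inj₁ none = inj₁ λ { z (here refl) → ¬Sx ; z (there z∈L) → none z z∈L }
      ... | yes Sx | inj₁ none =
            inj₂ (x , Sx , λ { z (here refl) _ → ⊏-irrefl ; z (there z∈L) Sz → ⊥-elim (none z z∈L Sz) })
      ... | no ¬Sx | inj₂ (m , Sm , below) =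
            inj₂ (m , Sm , λ { z (here refl) Sz → ⊥-elim (¬Sx Sz) ; z (there z∈L) Sz → below z z∈L Sz })
      ... | yes Sx | inj₂ (m , Sm , below) with x ⊏? m
      ...   | yes x⊏m = inj₂ (x , Sx , λ { z (here refl) _ → ⊏-irrefl
                                          ; z (there z∈L) Sz z⊏x → below z z∈L Sz (⊏-trans z⊏x x⊏m) })
      ...   | no x⋢m  = inj₂ (m , Sm , λ { z (here refl) _ → x⋢m ; z (there z∈L) Sz → below z z∈L Sz })
    ... | inj₁ none            = ⊥-elim (none z₀ (∈-allFin z₀) Sz₀)
    ... | inj₂ (m , Sm , below) = m , Sm , λ z → below z (∈-allFin z)

    InD? : (D : List (Fin n × Fin n)) (u v : Fin n) → Dec (InD D u v)
    InD? D u v = ((u , v) ∈ˡ? D) ⊎-dec ((v , u) ∈ˡ? D)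
      where open DecMembership (≡-dec _≟_ _≟_) using () renaming (_∈?_ to _∈ˡ?_)

    Consec? : (W : Subset n) (x y : Fin n) → Dec (Consec W x y)
    Consec? W x y = (x ∈ˢ? W) ×-dec (y ∈ˢ? W) ×-dec ¬? (x ≟ y) ×-dec
                    all? (λ w → (w ∈ˢ? W) →-dec ¬? (Cyc? x w y))

module RestrictedSums {c ℓ} (M : CommutativeMonoid c ℓ) where
  open CommutativeMonoid M renaming (ε to 0#)
  open import Algebra.Properties.CommutativeMonoid.Sum M using (sum)
  open import Data.Nat using (zero; suc)
  open import Data.Fin using (zero; suc)
  open import Data.Bool using (if_then_else_)
  open import Data.Empty using (⊥-elim)
  open import Relation.Nullary using (¬_; Dec; yes; no; does)
  open import Relation.Binary.PropositionalEquality as ≡ using (_≡_)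
  open import Function using (_∘_)

  restrict : ∀ {s} {P : Fin s → Set} → (∀ i → Dec (P i)) → (Fin s → Carrier) → Fin s → Carrier
  restrict P? g i = if does (P? i) then g i else 0#

  sum-restrict-none : ∀ {s} {P : Fin s → Set} (P? : ∀ i → Dec (P i)) (g : Fin s → Carrier) →
                      (∀ i → ¬ P i) → sum (restrict P? g) ≈ 0#
  sum-restrict-none {zero}  P? g none = refl
  sum-restrict-none {suc s} P? g none with P? zero
  ... | yes P0 = ⊥-elim (none zero P0)
  ... | no _   = trans (identityˡ _) (sum-restrict-none (P? ∘ suc) (g ∘ suc) (none ∘ suc))

  sum-restrict-unique : ∀ {s} {P : Fin s → Set} (P? : ∀ i → Dec (P i)) (g : Fin s → Carrier) →
                        (∀ i k → P i → P k → i ≡ k) → ∀ j → P j → sum (restrict P? g) ≈ g j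
  sum-restrict-unique {suc s} P? g unique zero P0 with P? zero
  ... | yes _  = trans (∙-congˡ (sum-restrict-none (P? ∘ suc) (g ∘ suc) (λ i Pi → suc≢zero (unique _ _ Pi P0))))
                       (identityʳ _)
    where
    suc≢zero : ∀ {i : Fin s} → ¬ suc i ≡ zero
    suc≢zero ()
  ... | no ¬P0 = ⊥-elim (¬P0 P0)
  sum-restrict-unique {suc s} P? g unique (suc j) Pj with P? zero
  ... | yes P0 = ⊥-elim (zero≢suc (unique _ _ P0 Pj))
    where
    zero≢suc : ¬ zero ≡ suc j
    zero≢suc ()
  ... | no _   = trans (identityˡ _) (sum-restrict-unique (P? ∘ suc) (g ∘ suc) (λ i k Pi Pk → suc-injective (unique _ _ Pi Pk)) j Pj)
    where
    suc-injective : ∀ {i k : Fin s} → suc i ≡ suc k → i ≡ k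
    suc-injective ≡.refl = ≡.refl

-- Cutting the cycle open at a vertex a: x ≺ y := Cyc a x y is a strict linear
-- order on the other vertices (the order in which they are met going around from a).
module SeenFrom {n : ℕ} (a : Fin n) where
  open CyclicOrder
  open import Data.Fin.Properties using (_≟_)
  open import Data.Product using (_,_)
  open import Data.Sum using (_⊎_; inj₁; inj₂)
  open import Data.Empty using (⊥-elim)
  open import Relation.Nullary using (¬_; Dec; yes; no)
  open import Relation.Nullary.Decidable using (_⊎-dec_)
  open import Relation.Binary.PropositionalEquality using (_≡_; _≢_; refl; sym)

  private
    variable
      x y z : Fin n

  _≺_ : Fin n → Fin n → Set
  x ≺ y = Cyc a x y

  _≼_ : Fin n → Fin n → Set
  x ≼ y = x ≺ y ⊎ x ≡ y

  _≺?_ : ∀ x y → Dec (x ≺ y)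
  x ≺? y = Cyc? a x y

  _≼?_ : ∀ x y → Dec (x ≼ y)
  x ≼? y = (x ≺? y) ⊎-dec (x ≟ y)

  ≺-trans : x ≺ y → y ≺ z → x ≺ z
  ≺-trans = Cyc-trans

  ≺-asym : x ≺ y → ¬ y ≺ x
  ≺-asym = Cyc-asym

  ≺-irrefl : ¬ x ≺ x
  ≺-irrefl = Cyc-irreflʳ

  ≺⇒≢ : x ≺ y → x ≢ y
  ≺⇒≢ x≺y refl = ≺-irrefl x≺y

  ≺⇒≢aˡ : x ≺ y → x ≢ a
  ≺⇒≢aˡ x≺y refl = Cyc-irreflˡ x≺y

  ≺⇒≢aʳ : x ≺ y → y ≢ a
  ≺⇒≢aʳ x≺y refl = Cyc-irrefl-ends x≺y

  ≼⇒≢aʳ : x ≼ y → x ≢ a → y ≢ a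
  ≼⇒≢aʳ (inj₁ x≺y) _   = ≺⇒≢aʳ x≺y
  ≼⇒≢aʳ (inj₂ refl) x≢a = x≢a

  trichotomy : x ≢ a → y ≢ a → x ≺ y ⊎ x ≡ y ⊎ y ≺ x
  trichotomy {x} {y} x≢a y≢a with x ≟ y
  ... | yes x≡y = inj₂ (inj₁ x≡y)
  ... | no x≢y with Cyc-total x≢y x≢a y≢a
  ...   | inj₁ x≺y = inj₁ x≺y
  ...   | inj₂ y≺x = inj₂ (inj₂ y≺x)

  ≮⇒≽ : x ≢ a → y ≢ a → ¬ x ≺ y → y ≼ x
  ≮⇒≽ x≢a y≢a x⊀y with trichotomy x≢a y≢a
  ... | inj₁ x≺y        = ⊥-elim (x⊀y x≺y)
  ... | inj₂ (inj₁ x≡y) = inj₂ (sym x≡y)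
  ... | inj₂ (inj₂ y≺x) = inj₁ y≺x

  ≼-≺-trans : x ≼ y → y ≺ z → x ≺ z
  ≼-≺-trans (inj₁ x≺y) y≺z = ≺-trans x≺y y≺z
  ≼-≺-trans (inj₂ refl) y≺z = y≺z

  ≺-≼-trans : x ≺ y → y ≼ z → x ≺ z
  ≺-≼-trans x≺y (inj₁ y≺z) = ≺-trans x≺y y≺z
  ≺-≼-trans x≺y (inj₂ refl) = x≺y

  ≼∧≢⇒≺ : x ≼ y → x ≢ y → x ≺ y
  ≼∧≢⇒≺ (inj₁ x≺y) _   = x≺y
  ≼∧≢⇒≺ (inj₂ x≡y) x≢y = ⊥-elim (x≢y x≡y)

  ≺⇒Cyc : x ≺ y → y ≺ z → Cyc x y z
  ≺⇒Cyc = Cyc-between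

  Cyc⇒≺ : Cyc x y z → y ≢ a → x ≺ z → x ≺ y × y ≺ z
  Cyc⇒≺ {x} {y} {z} xyz y≢a x≺z with trichotomy y≢a (≺⇒≢aˡ x≺z)
  ... | inj₁ y≺x        = ⊥-elim (Cyc-asym xyz (Cyc-rotate (≺⇒Cyc y≺x x≺z)))
  ... | inj₂ (inj₁ refl) = ⊥-elim (Cyc-irreflˡ xyz)
  ... | inj₂ (inj₂ x≺y) with trichotomy y≢a (≺⇒≢aʳ x≺z)
  ...   | inj₁ y≺z        = x≺y , y≺z
  ...   | inj₂ (inj₁ refl) = ⊥-elim (Cyc-irreflʳ xyz)
  ...   | inj₂ (inj₂ z≺y) = ⊥-elim (Cyc-asym xyz (≺⇒Cyc x≺z z≺y))

  Cyc-through-a : Cyc x a z → z ≺ x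
  Cyc-through-a = Cyc-rotate

  ≻⇒Cyc-through-a : z ≺ x → Cyc x a z
  ≻⇒Cyc-through-a z≺x = Cyc-rotate (Cyc-rotate z≺x)

  ≺⇒Cyc-to-a : x ≺ y → Cyc x y a
  ≺⇒Cyc-to-a = Cyc-rotate

  Cyc-to-a⇒≺ : Cyc x y a → x ≺ y
  Cyc-to-a⇒≺ c = Cyc-rotate (Cyc-rotate c)

module Dissection {n : ℕ} (D : List (Fin n × Fin n)) (dis : IsDissection D) where
  open import Data.Product using (_,_; proj₁; proj₂)
  open import Data.Sum using (inj₁; inj₂)
  open import Data.Empty using (⊥)
  open import Relation.Binary.PropositionalEquality using (_≢_; sym)
  open CyclicOrder using (Cyc-rotate)

  private
    variable
      u v w x y z : Fin n

  InD-sym : InD D u v → InD D v u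
  InD-sym (inj₁ m) = inj₂ m
  InD-sym (inj₂ m) = inj₁ m

  InD⇒≢ : InD D u v → u ≢ v
  InD⇒≢ (inj₁ m)   = proj₁ (proj₁ dis _ m)
  InD⇒≢ (inj₂ m) e = proj₁ (proj₁ dis _ m) (sym e)

  no-crossing : Cyc x y z → Cyc x z w → InD D x z → InD D y w → ⊥
  no-crossing c₁ c₂ (inj₁ m₁) (inj₁ m₂) = proj₂ dis _ _ m₁ m₂ (inj₁ (c₁ , c₂))
  no-crossing c₁ c₂ (inj₁ m₁) (inj₂ m₂) = proj₂ dis _ _ m₁ m₂ (inj₂ (c₁ , c₂))
  no-crossing c₁ c₂ (inj₂ m₁) (inj₁ m₂) = proj₂ dis _ _ m₁ m₂ (inj₂ (Cyc-rotate c₂ , Cyc-rotate (Cyc-rotate c₁)))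
  no-crossing c₁ c₂ (inj₂ m₁) (inj₂ m₂) = proj₂ dis _ _ m₁ m₂ (inj₁ (Cyc-rotate c₂ , Cyc-rotate (Cyc-rotate c₁)))

module Fan {n : ℕ} (D : List (Fin n × Fin n)) (dis : IsDissection D)
           (a a⁻ a⁺ : Fin n) (a⁻a : Consec ⊤ a⁻ a) (aa⁺ : Consec ⊤ a a⁺) where
  open CyclicOrder
  open SeenFrom a public
  open Dissection D dis public
  open FiniteSets
  open import Data.Fin.Properties using (_≟_; any?)
  open import Data.Fin.Subset.Properties using (∈⊤; ∣⊤∣≡n)
  open import Data.Vec using (tabulate)
  open import Data.Vec.Properties using (lookup∘tabulate; []=⇒lookup; lookup⇒[]=)
  open import Data.Bool using (true)
  open import Data.Product using (∃; _,_; proj₁; proj₂)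
  open import Data.Sum using (_⊎_; inj₁; inj₂)
  open import Data.Empty using (⊥; ⊥-elim)
  open import Relation.Nullary using (¬_; Dec; yes; no; does)
  open import Relation.Nullary.Decidable using (_×-dec_; _⊎-dec_; ¬?; dec-true)
  open import Relation.Binary.PropositionalEquality using (_≡_; _≢_; refl; sym; trans; subst)

  private
    variable
      w x y z : Fin n

  a⁺≢a : a⁺ ≢ a
  a⁺≢a e = proj₁ (proj₂ (proj₂ aa⁺)) (sym e)

  a⁻≢a : a⁻ ≢ a
  a⁻≢a = proj₁ (proj₂ (proj₂ a⁻a))

  ⊀a⁺ : ¬ x ≺ a⁺
  ⊀a⁺ {x} x≺a⁺ = proj₂ (proj₂ (proj₂ aa⁺)) x ∈⊤ x≺a⁺

  a⁻⊀ : ¬ a⁻ ≺ x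
  a⁻⊀ {x} a⁻≺x = proj₂ (proj₂ (proj₂ a⁻a)) x ∈⊤ (≺⇒Cyc-to-a a⁻≺x)

  a⁺-least : x ≢ a → x ≢ a⁺ → a⁺ ≺ x
  a⁺-least x≢a x≢a⁺ with trichotomy x≢a a⁺≢a
  ... | inj₁ x≺a⁺        = ⊥-elim (⊀a⁺ x≺a⁺)
  ... | inj₂ (inj₁ x≡a⁺) = ⊥-elim (x≢a⁺ x≡a⁺)
  ... | inj₂ (inj₂ a⁺≺x) = a⁺≺x

  a⁺-first : x ≢ a → x ≡ a⁺ ⊎ a⁺ ≺ x
  a⁺-first {x} x≢a with x ≟ a⁺
  ... | yes x≡a⁺ = inj₁ x≡a⁺
  ... | no x≢a⁺  = inj₂ (a⁺-least x≢a x≢a⁺)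

  a⁻-greatest : x ≢ a → x ≢ a⁻ → x ≺ a⁻
  a⁻-greatest x≢a x≢a⁻ with trichotomy x≢a a⁻≢a
  ... | inj₁ x≺a⁻        = x≺a⁻
  ... | inj₂ (inj₁ x≡a⁻) = ⊥-elim (x≢a⁻ x≡a⁻)
  ... | inj₂ (inj₂ a⁻≺x) = ⊥-elim (a⁻⊀ a⁻≺x)

  -- In a polygon with at least three vertices a⁻ ≠ a⁺: a third vertex lies strictly between them.
  a⁻≢a⁺ : 3 ≤ n → a⁻ ≢ a⁺
  a⁻≢a⁺ n≥3 a⁻≡a⁺ with member-avoiding {W = ⊤} (subst (3 ≤_) (sym (∣⊤∣≡n n)) n≥3) a a⁺
  ... | y , _ , y≢a , y≢a⁺ =
        ≺-asym (a⁺-least y≢a y≢a⁺) (subst (y ≺_) a⁻≡a⁺ (a⁻-greatest y≢a (λ e → y≢a⁺ (trans e a⁻≡a⁺))))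

  successor-unique : ∀ {W} → Consec W a x → Consec W a y → x ≡ y
  successor-unique {x} {y} (_ , xW , a≢x , x-first) (_ , yW , a≢y , y-first)
    with trichotomy (λ e → a≢x (sym e)) (λ e → a≢y (sym e))
  ... | inj₁ x≺y        = ⊥-elim (y-first x xW x≺y)
  ... | inj₂ (inj₁ x≡y) = x≡y
  ... | inj₂ (inj₂ y≺x) = ⊥-elim (x-first y yW y≺x)

  predecessor-unique : ∀ {W} → Consec W x a → Consec W y a → x ≡ y
  predecessor-unique {x} {y} (xW , _ , x≢a , x-last) (yW , _ , y≢a , y-last) with trichotomy x≢a y≢a
  ... | inj₁ x≺y        = ⊥-elim (x-last y yW (≺⇒Cyc-to-a x≺y))
  ... | inj₂ (inj₁ x≡y) = x≡y
  ... | inj₂ (inj₂ y≺x) = ⊥-elim (y-last x xW (≺⇒Cyc-to-a y≺x))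

  no-crossing≺ : x ≺ y → y ≺ z → z ≺ w → InD D x z → InD D y w → ⊥
  no-crossing≺ x≺y y≺z z≺w = no-crossing (≺⇒Cyc x≺y y≺z) (≺⇒Cyc (≺-trans x≺y y≺z) z≺w)

  InFan : Fin n → Set
  InFan m = m ≡ a⁺ ⊎ m ≡ a⁻ ⊎ InD D a m

  InFan? : ∀ m → Dec (InFan m)
  InFan? m = (m ≟ a⁺) ⊎-dec (m ≟ a⁻) ⊎-dec InD? D a m

  InFan⇒≢a : InFan x → x ≢ a
  InFan⇒≢a (inj₁ refl)         = a⁺≢a
  InFan⇒≢a (inj₂ (inj₁ refl))  = a⁻≢a
  InFan⇒≢a (inj₂ (inj₂ a—x)) e = InD⇒≢ a—x (sym e)

  FanConsecutive : Fin n → Fin n → Set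
  FanConsecutive l r = l ≺ r × ∀ m → InFan m → ¬ (l ≺ m × m ≺ r)

  minimal≺ : (S : Fin n → Set) → (∀ x → Dec (S x)) → ∃ S → ∃ λ m → S m × ∀ z → S z → ¬ z ≺ m
  minimal≺ = minimal _≺_ _≺?_ ≺-trans ≺-irrefl

  maximal≺ : (S : Fin n → Set) → (∀ x → Dec (S x)) → ∃ S → ∃ λ m → S m × ∀ z → S z → ¬ m ≺ z
  maximal≺ = minimal (λ x y → y ≺ x) (λ x y → y ≺? x) (λ x≻y y≻z → ≺-trans y≻z x≻y) ≺-irrefl

  -- The vertices of the arc from l to r that are visible from a, i.e. not cut off
  -- by a diagonal u—v with l ≼ u ≺ z ≺ v ≼ r; together with a they form the
  -- candidate subpolygon spanned by a, l and r.
  module Arc (l r : Fin n) where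
    CutOffBy : Fin n → Fin n → Fin n → Set
    CutOffBy u v z = InD D u v × l ≼ u × u ≺ z × z ≺ v × v ≼ r

    CutOffBy? : ∀ u v z → Dec (CutOffBy u v z)
    CutOffBy? u v z = InD? D u v ×-dec (l ≼? u) ×-dec (u ≺? z) ×-dec (z ≺? v) ×-dec (v ≼? r)

    CutOff : Fin n → Set
    CutOff z = ∃ λ u → ∃ λ v → CutOffBy u v z

    CutOff? : ∀ z → Dec (CutOff z)
    CutOff? z = any? (λ u → any? (λ v → CutOffBy? u v z))

    Visible : Fin n → Set
    Visible z = z ≡ a ⊎ ((l ≼ z × z ≼ r) × ¬ CutOff z)

    Visible? : ∀ z → Dec (Visible z)
    Visible? z = (z ≟ a) ⊎-dec (((l ≼? z) ×-dec (z ≼? r)) ×-dec ¬? (CutOff? z))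

    visible : Subset n
    visible = tabulate (λ z → does (Visible? z))

    visible⇒Visible : z ∈ visible → Visible z
    visible⇒Visible {z} z∈ = witness (Visible? z) (trans (sym (lookup∘tabulate _ z)) ([]=⇒lookup z∈))
      where
      witness : ∀ {P : Set} (d : Dec P) → does d ≡ true → P
      witness (yes p) _ = p

    Visible⇒visible : Visible z → z ∈ visible
    Visible⇒visible {z} vis = lookup⇒[]= z visible (trans (lookup∘tabulate _ z) (dec-true (Visible? z) vis))

-- A subpolygon V incident with a is determined by the successor of a in V: its last
-- vertex is the next fan vertex, and V is the set of vertices visible from a in between.
module IncidentSubpolygons {n : ℕ} (D : List (Fin n × Fin n)) (dis : IsDissection D)
           (a a⁻ a⁺ : Fin n) (a⁻a : Consec ⊤ a⁻ a) (aa⁺ : Consec ⊤ a a⁺) where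
  open CyclicOrder
  open Fan D dis a a⁻ a⁺ a⁻a aa⁺
  open FiniteSets
  open import Data.Fin.Properties using (_≟_)
  open import Data.Fin.Subset using (_∉_)
  open import Data.Fin.Subset.Properties using (∈⊤; ⊆-antisym) renaming (_∈?_ to _∈ˢ?_)
  open import Data.Product using (∃; _,_; proj₁; proj₂)
  open import Data.Sum using (_⊎_; inj₁; inj₂)
  open import Data.Empty using (⊥-elim)
  open import Relation.Nullary using (¬_; yes; no)
  open import Relation.Nullary.Decidable using (_×-dec_; ¬?)
  open import Relation.Binary.PropositionalEquality using (_≡_; _≢_; refl; sym; trans; subst; cong)

  private
    variable
      x z : Fin n

  module Wedge (V : Subset n) (sV : IsSubpolygon D V) (aV : a ∈ V) where
    private
      sides : ∀ x y → Consec V x y → Consec ⊤ x y ⊎ InD D x y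
      sides = proj₁ (proj₂ sV)
      diagonals : ∀ x y → InD D x y → x ∈ V → y ∈ V → Consec V x y ⊎ Consec V y x
      diagonals = proj₂ (proj₂ sV)

      other-vertex : ∃ λ y → y ∈ V × y ≢ a
      other-vertex with member-avoiding (proj₁ sV) a a
      ... | y , yV , y≢a , _ = y , yV , y≢a

    successor : ∃ λ q → Consec V a q
    successor with minimal≺ (λ z → z ∈ V × z ≢ a) (λ z → (z ∈ˢ? V) ×-dec ¬? (z ≟ a)) other-vertex
    ... | q , (qV , q≢a) , least = q , aV , qV , (λ e → q≢a (sym e)) , λ w wV c → least w (wV , ≺⇒≢aˡ c) c

    predecessor : ∃ λ p → Consec V p a
    predecessor with maximal≺ (λ z → z ∈ V × z ≢ a) (λ z → (z ∈ˢ? V) ×-dec ¬? (z ≟ a)) other-vertex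
    ... | p , (pV , p≢a) , greatest =
          p , pV , aV , p≢a , λ w wV c → greatest w (wV , ≺⇒≢aʳ (Cyc-to-a⇒≺ c)) (Cyc-to-a⇒≺ c)

    module Ends (q p : Fin n) (aq : Consec V a q) (pa : Consec V p a) where
      qV : q ∈ V
      qV = proj₁ (proj₂ aq)
      pV : p ∈ V
      pV = proj₁ pa
      q≢a : q ≢ a
      q≢a e = proj₁ (proj₂ (proj₂ aq)) (sym e)
      p≢a : p ≢ a
      p≢a = proj₁ (proj₂ (proj₂ pa))

      between : z ∈ V → z ≢ a → q ≼ z × z ≼ p
      between {z} zV z≢a = ≮⇒≽ z≢a q≢a (proj₂ (proj₂ (proj₂ aq)) z zV)
                         , ≮⇒≽ p≢a z≢a (λ p≺z → proj₂ (proj₂ (proj₂ pa)) z zV (≺⇒Cyc-to-a p≺z))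

      q≺p : q ≺ p
      q≺p with member-avoiding (proj₁ sV) a q
      ... | y , yV , y≢a , y≢q with between yV y≢a
      ...   | inj₁ q≺y , y≼p = ≺-≼-trans q≺y y≼p
      ...   | inj₂ q≡y , _   = ⊥-elim (y≢q (sym q≡y))

      cut-off-by-side : z ∉ V → z ≢ a → q ≼ z → z ≼ p →
                        ∃ λ y → ∃ λ y' → Consec V y y' × y ≺ z × z ≺ y' × InD D y y' × q ≼ y × y' ≼ p
      cut-off-by-side {z} z∉V z≢a q≼z z≼p =
        y , y' , yy' , y≺z , z≺y' , y—y' , proj₁ (between yV y≢a) , proj₂ (between y'V y'≢a)
        where
        q≺z : q ≺ z
        q≺z = ≼∧≢⇒≺ q≼z (λ e → z∉V (subst (_∈ V) e qV))
        z≺p : z ≺ p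
        z≺p = ≼∧≢⇒≺ z≼p (λ e → z∉V (subst (_∈ V) (sym e) pV))
        before = maximal≺ (λ w → w ∈ V × w ≢ a × w ≺ z) (λ w → (w ∈ˢ? V) ×-dec ¬? (w ≟ a) ×-dec (w ≺? z))
                          (q , qV , q≢a , q≺z)
        after  = minimal≺ (λ w → w ∈ V × w ≢ a × z ≺ w) (λ w → (w ∈ˢ? V) ×-dec ¬? (w ≟ a) ×-dec (z ≺? w))
                          (p , pV , p≢a , z≺p)
        y = proj₁ before
        y' = proj₁ after
        yV = proj₁ (proj₁ (proj₂ before))
        y≢a = proj₁ (proj₂ (proj₁ (proj₂ before)))
        y≺z = proj₂ (proj₂ (proj₁ (proj₂ before)))
        y'V = proj₁ (proj₁ (proj₂ after))
        y'≢a = proj₁ (proj₂ (proj₁ (proj₂ after)))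
        z≺y' = proj₂ (proj₂ (proj₁ (proj₂ after)))
        y≺y' = ≺-trans y≺z z≺y'
        yy' : Consec V y y'
        yy' = yV , y'V , ≺⇒≢ y≺y' , nothing-between
          where
          nothing-between : ∀ w → w ∈ V → ¬ Cyc y w y'
          nothing-between w wV c with w ≟ a
          ... | yes refl = ≺-asym y≺y' (Cyc-through-a c)
          ... | no w≢a with Cyc⇒≺ c w≢a y≺y'
          ...   | y≺w , w≺y' with trichotomy w≢a z≢a
          ...     | inj₁ w≺z        = proj₂ (proj₂ before) w (wV , w≢a , w≺z) y≺w
          ...     | inj₂ (inj₁ refl) = z∉V wV
          ...     | inj₂ (inj₂ z≺w) = proj₂ (proj₂ after) w (wV , w≢a , z≺w) w≺y'
        y—y' : InD D y y'
        y—y' with sides y y' yy'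
        ... | inj₁ side = ⊥-elim (proj₂ (proj₂ (proj₂ side)) z ∈⊤ (≺⇒Cyc y≺z z≺y'))
        ... | inj₂ diagonal = diagonal

      no-fan-between : ∀ m → InFan m → ¬ (q ≺ m × m ≺ p)
      no-fan-between m (inj₁ refl) (q≺m , _) = ⊀a⁺ q≺m
      no-fan-between m (inj₂ (inj₁ refl)) (_ , m≺p) = a⁻⊀ m≺p
      no-fan-between m (inj₂ (inj₂ a—m)) (q≺m , m≺p) with m ∈ˢ? V
      ... | yes mV with diagonals a m a—m aV mV
      ...   | inj₁ am with successor-unique aq am
      ...     | refl = ≺-irrefl q≺m
      no-fan-between m (inj₂ (inj₂ a—m)) (q≺m , m≺p) | yes mV | inj₂ ma with predecessor-unique pa ma
      ...     | refl = ≺-irrefl m≺p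
      no-fan-between m (inj₂ (inj₂ a—m)) (q≺m , m≺p) | no m∉V
        with cut-off-by-side m∉V (≺⇒≢aʳ q≺m) (inj₁ q≺m) (inj₁ m≺p)
      ... | y , y' , _ , y≺m , m≺y' , y—y' , _ = no-crossing y≺m m≺y' a—m y—y'

      open Arc q p

      V⊆visible : z ∈ V → Visible z
      V⊆visible {z} zV with z ≟ a
      ... | yes z≡a = inj₁ z≡a
      ... | no z≢a = inj₂ (between zV z≢a , not-cut-off)
        where
        not-cut-off : ¬ CutOff z
        not-cut-off (u , v , u—v , q≼u , u≺z , z≺v , v≼p) with u ∈ˢ? V
        ... | no u∉V with cut-off-by-side u∉V (≺⇒≢aˡ u≺z) q≼u (inj₁ (≺-trans u≺z (≺-≼-trans z≺v v≼p)))
        ...   | y , y' , yy' , y≺u , u≺y' , y—y' , _ =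
                no-crossing≺ y≺u u≺y'
                  (≼-≺-trans (≮⇒≽ z≢a (≺⇒≢aʳ u≺y')
                    (λ z≺y' → proj₂ (proj₂ (proj₂ yy')) z zV (≺⇒Cyc (≺-trans y≺u u≺z) z≺y'))) z≺v)
                  y—y' u—v
        not-cut-off (u , v , u—v , q≼u , u≺z , z≺v , v≼p) | yes uV with v ∈ˢ? V
        ... | no v∉V with cut-off-by-side v∉V (≺⇒≢aʳ z≺v) (inj₁ (≼-≺-trans q≼u (≺-trans u≺z z≺v))) v≼p
        ...   | y , y' , yy' , y≺v , v≺y' , y—y' , _ =
                no-crossing≺
                  (≺-≼-trans u≺z (≮⇒≽ (≺⇒≢aˡ y≺v) z≢a
                    (λ y≺z → proj₂ (proj₂ (proj₂ yy')) z zV (≺⇒Cyc y≺z (≺-trans z≺v v≺y')))))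
                  y≺v v≺y' u—v y—y'
        not-cut-off (u , v , u—v , q≼u , u≺z , z≺v , v≼p) | yes uV | yes vV with diagonals u v u—v uV vV
        ... | inj₁ uv = proj₂ (proj₂ (proj₂ uv)) z zV (≺⇒Cyc u≺z z≺v)
        ... | inj₂ vu = proj₂ (proj₂ (proj₂ vu)) a aV (≻⇒Cyc-through-a (≺-trans u≺z z≺v))

      visible⊆V : Visible z → z ∈ V
      visible⊆V (inj₁ refl) = aV
      visible⊆V {z} (inj₂ ((q≼z , z≼p) , not-cut-off)) with z ∈ˢ? V
      ... | yes zV = zV
      ... | no z∉V with cut-off-by-side z∉V (≼⇒≢aʳ q≼z q≢a) q≼z z≼p
      ...   | y , y' , _ , y≺z , z≺y' , y—y' , q≼y , y'≼p = ⊥-elim (not-cut-off (y , y' , y—y' , q≼y , y≺z , z≺y' , y'≼p))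

      V≡visible : V ≡ visible
      V≡visible = ⊆-antisym (λ z∈V → Visible⇒visible (V⊆visible z∈V)) (λ z∈vis → visible⊆V (visible⇒Visible z∈vis))

    successor-inFan : Consec V a x → InFan x × x ≢ a⁻
    successor-inFan {x} ax with predecessor
    ... | p , pa = inFan , x≢a⁻
      where
      inFan : InFan x
      inFan with sides a x ax
      ... | inj₁ side = inj₁ (successor-unique side aa⁺)
      ... | inj₂ diagonal = inj₂ (inj₂ diagonal)
      x≢a⁻ : x ≢ a⁻
      x≢a⁻ refl = a⁻⊀ (Ends.q≺p x p ax pa)

    predecessor-inFan : Consec V x a → InFan x × x ≢ a⁺
    predecessor-inFan {x} xa with successor
    ... | q , aq = inFan , x≢a⁺
      where
      inFan : InFan x
      inFan with sides x a xa
      ... | inj₁ side = inj₂ (inj₁ (predecessor-unique side a⁻a))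
      ... | inj₂ diagonal = inj₂ (inj₂ (InD-sym diagonal))
      x≢a⁺ : x ≢ a⁺
      x≢a⁺ refl = ⊀a⁺ (Ends.q≺p q x aq xa)

  unique-by-successor : ∀ {V V' x} → IsSubpolygon D V → a ∈ V → IsSubpolygon D V' → a ∈ V' →
                        Consec V a x → Consec V' a x → V ≡ V'
  unique-by-successor {V} {V'} {x} sV aV sV' aV' ax ax' with Wedge.predecessor V sV aV | Wedge.predecessor V' sV' aV'
  ... | p , pa | p' , p'a = trans E.V≡visible (trans (cong (Arc.visible x) p≡p') (sym E'.V≡visible))
    where
    module E  = Wedge.Ends V sV aV x p ax pa
    module E' = Wedge.Ends V' sV' aV' x p' ax' p'a
    p≡p' : p ≡ p'
    p≡p' with trichotomy E.p≢a E'.p≢a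
    ... | inj₁ p≺p'        = ⊥-elim (E'.no-fan-between p (proj₁ (Wedge.predecessor-inFan V sV aV pa)) (E.q≺p , p≺p'))
    ... | inj₂ (inj₁ p≡p') = p≡p'
    ... | inj₂ (inj₂ p'≺p) = ⊥-elim (E.no-fan-between p' (proj₁ (Wedge.predecessor-inFan V' sV' aV' p'a)) (E'.q≺p , p'≺p))

  unique-by-predecessor : ∀ {V V' x} → IsSubpolygon D V → a ∈ V → IsSubpolygon D V' → a ∈ V' →
                          Consec V x a → Consec V' x a → V ≡ V'
  unique-by-predecessor {V} {V'} {x} sV aV sV' aV' xa xa' with Wedge.successor V sV aV | Wedge.successor V' sV' aV'
  ... | q , aq | q' , aq' = trans E.V≡visible (trans (cong (λ l → Arc.visible l x) q≡q') (sym E'.V≡visible))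
    where
    module E  = Wedge.Ends V sV aV q x aq xa
    module E' = Wedge.Ends V' sV' aV' q' x aq' xa'
    q≡q' : q ≡ q'
    q≡q' with trichotomy E.q≢a E'.q≢a
    ... | inj₁ q≺q'        = ⊥-elim (E.no-fan-between q' (proj₁ (Wedge.successor-inFan V' sV' aV' aq')) (q≺q' , E'.q≺p))
    ... | inj₂ (inj₁ q≡q') = q≡q'
    ... | inj₂ (inj₂ q'≺q) = ⊥-elim (E'.no-fan-between q (proj₁ (Wedge.successor-inFan V sV aV aq)) (q'≺q , E.q≺p))

-- Conversely, for consecutive fan vertices l ≺ r, the vertices visible from a between
-- l and r, together with a, form a subpolygon in which l follows a and r precedes a.
module WedgeConstruction {n : ℕ} (D : List (Fin n × Fin n)) (dis : IsDissection D)
           (a a⁻ a⁺ : Fin n) (a⁻a : Consec ⊤ a⁻ a) (aa⁺ : Consec ⊤ a a⁺) where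
  open CyclicOrder
  open Fan D dis a a⁻ a⁺ a⁻a aa⁺
  open FiniteSets
  open import Data.Fin.Properties using (_≟_; any?)
  open import Data.Fin.Subset using (∣_∣)
  open import Data.Fin.Subset.Properties using (∈⊤)
  open import Data.Product using (∃; _,_; proj₁; proj₂)
  open import Data.Sum using (_⊎_; inj₁; inj₂)
  open import Data.Empty using (⊥-elim)
  open import Relation.Nullary using (¬_; yes; no)
  open import Relation.Nullary.Decidable using (_×-dec_)
  open import Relation.Binary.PropositionalEquality using (_≡_; _≢_; refl; sym; subst₂)

  module Spanned (l r : Fin n) (lFan : InFan l) (rFan : InFan r) (lr : FanConsecutive l r) where
    open Arc l r

    W : Subset n
    W = visible

    l≺r : l ≺ r
    l≺r = proj₁ lr
    l≢a : l ≢ a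
    l≢a = ≺⇒≢aˡ l≺r
    r≢a : r ≢ a
    r≢a = ≺⇒≢aʳ l≺r

    aW : a ∈ W
    aW = Visible⇒visible (inj₁ refl)
    lW : l ∈ W
    lW = Visible⇒visible (inj₂ ((inj₂ refl , inj₁ l≺r) , λ { (u , v , _ , l≼u , u≺l , _) → ≺-irrefl (≼-≺-trans l≼u u≺l) }))
    rW : r ∈ W
    rW = Visible⇒visible (inj₂ ((inj₁ l≺r , inj₂ refl) , λ { (u , v , _ , _ , _ , r≺v , v≼r) → ≺-irrefl (≺-≼-trans r≺v v≼r) }))

    W-other : ∀ {z} → z ∈ W → z ≢ a → (l ≼ z × z ≼ r) × ¬ CutOff z
    W-other z∈W z≢a with visible⇒Visible z∈W
    ... | inj₁ z≡a = ⊥-elim (z≢a z≡a)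
    ... | inj₂ vis = vis

    al : Consec W a l
    al = aW , lW , (λ e → l≢a (sym e)) , nothing-between
      where
      nothing-between : ∀ w → w ∈ W → ¬ Cyc a w l
      nothing-between w wW w≺l with w ≟ a
      ... | yes refl = Cyc-irreflˡ w≺l
      ... | no w≢a = ≺-irrefl (≼-≺-trans (proj₁ (proj₁ (W-other wW w≢a))) w≺l)

    ra : Consec W r a
    ra = rW , aW , r≢a , λ w wW c →
           ≺-irrefl (≺-≼-trans (Cyc-to-a⇒≺ c) (proj₂ (proj₁ (W-other wW (≺⇒≢aʳ (Cyc-to-a⇒≺ c))))))

    three-vertices : 3 ≤ ∣ W ∣
    three-vertices = three-members aW lW rW (λ e → l≢a (sym e)) (λ e → r≢a (sym e)) (≺⇒≢ l≺r)

    fan-in-arc : ∀ {z} → InFan z → l ≼ z → z ≼ r → z ≡ l ⊎ z ≡ r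
    fan-in-arc {z} zFan l≼z z≼r with z ≟ l
    ... | yes z≡l = inj₁ z≡l
    ... | no z≢l with z ≟ r
    ...   | yes z≡r = inj₂ z≡r
    ...   | no z≢r = ⊥-elim (proj₂ lr z zFan (≼∧≢⇒≺ l≼z (λ e → z≢l (sym e)) , ≼∧≢⇒≺ z≼r z≢r))

    gap-is-cut-off : ∀ {z z' w} → Consec W z z' → z ≢ a → z' ≢ a → z ≺ w → w ≺ z' → CutOff w
    gap-is-cut-off {z} {z'} {w} zz' z≢a z'≢a z≺w w≺z' with CutOff? w
    ... | yes cut = cut
    ... | no not-cut = ⊥-elim (proj₂ (proj₂ (proj₂ zz')) w
            (Visible⇒visible (inj₂ ((inj₁ (≼-≺-trans (proj₁ (proj₁ (W-other (proj₁ zz') z≢a))) z≺w) ,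
                                     inj₁ (≺-≼-trans w≺z' (proj₂ (proj₁ (W-other (proj₁ (proj₂ zz')) z'≢a))))) , not-cut)))
            (≺⇒Cyc z≺w w≺z'))

    -- The outermost diagonal u₀—v₀ cutting off w (u₀ minimal, then v₀ maximal) has visible
    -- ends, and therefore is the side z—z' of W over w.
    outermost-cut-is-side : ∀ {z z' w} → Consec W z z' → z ≢ a → z' ≢ a → z ≺ w → w ≺ z' →
                            (u₀ v₀ : Fin n) → CutOffBy u₀ v₀ w →
                            (∀ t → (∃ λ v → CutOffBy t v w) → ¬ t ≺ u₀) → (∀ v → CutOffBy u₀ v w → ¬ v₀ ≺ v) →
                            InD D z z'
    outermost-cut-is-side {z} {z'} {w} zz' z≢a z'≢a z≺w w≺z' u₀ v₀ (u₀—v₀ , l≼u₀ , u₀≺w , w≺v₀ , v₀≼r) u₀-min v₀-max =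
      subst₂ (InD D) u₀≡z v₀≡z' u₀—v₀
      where
      zW = proj₁ zz'
      z'W = proj₁ (proj₂ zz')
      nothing-between : ∀ t → t ∈ W → ¬ Cyc z t z'
      nothing-between = proj₂ (proj₂ (proj₂ zz'))
      w≢a : w ≢ a
      w≢a = ≺⇒≢aʳ z≺w
      u₀-visible : ¬ CutOff u₀
      u₀-visible (u , v , u—v , l≼u , u≺u₀ , u₀≺v , v≼r) = u₀-min u (v , u—v , l≼u , ≺-trans u≺u₀ u₀≺w , w≺v , v≼r) u≺u₀
        where
        w≺v : w ≺ v
        w≺v with trichotomy w≢a (≺⇒≢aʳ u₀≺v)
        ... | inj₁ w≺v        = w≺v
        ... | inj₂ (inj₁ refl) = ⊥-elim (no-crossing≺ u≺u₀ u₀≺v w≺v₀ u—v u₀—v₀)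
        ... | inj₂ (inj₂ v≺w) = ⊥-elim (no-crossing≺ u≺u₀ u₀≺v (≺-trans v≺w w≺v₀) u—v u₀—v₀)
      v₀-visible : ¬ CutOff v₀
      v₀-visible (u , v , u—v , l≼u , u≺v₀ , v₀≺v , v≼r) with trichotomy (≺⇒≢aˡ u₀≺w) (≺⇒≢aˡ u≺v₀)
      ... | inj₁ u₀≺u        = no-crossing≺ u₀≺u u≺v₀ v₀≺v u₀—v₀ u—v
      ... | inj₂ (inj₁ refl) = v₀-max v (u—v , l≼u , u₀≺w , ≺-trans w≺v₀ v₀≺v , v≼r) v₀≺v
      ... | inj₂ (inj₂ u≺u₀) = u₀-min u (v , u—v , l≼u , ≺-trans u≺u₀ u₀≺w , ≺-trans w≺v₀ v₀≺v , v≼r) u≺u₀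
      u₀W : u₀ ∈ W
      u₀W = Visible⇒visible (inj₂ ((l≼u₀ , inj₁ (≺-≼-trans (≺-trans u₀≺w w≺v₀) v₀≼r)) , u₀-visible))
      v₀W : v₀ ∈ W
      v₀W = Visible⇒visible (inj₂ ((inj₁ (≼-≺-trans l≼u₀ (≺-trans u₀≺w w≺v₀)) , v₀≼r) , v₀-visible))
      u₀≡z : u₀ ≡ z
      u₀≡z with trichotomy (≺⇒≢aˡ u₀≺w) z≢a
      ... | inj₁ u₀≺z        = ⊥-elim (proj₂ (W-other zW z≢a) (u₀ , v₀ , u₀—v₀ , l≼u₀ , u₀≺z , ≺-trans z≺w w≺v₀ , v₀≼r))
      ... | inj₂ (inj₁ u₀≡z) = u₀≡z
      ... | inj₂ (inj₂ z≺u₀) = ⊥-elim (nothing-between u₀ u₀W (≺⇒Cyc z≺u₀ (≺-trans u₀≺w w≺z')))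
      v₀≡z' : v₀ ≡ z'
      v₀≡z' with trichotomy (≺⇒≢aʳ w≺v₀) z'≢a
      ... | inj₁ v₀≺z'        = ⊥-elim (nothing-between v₀ v₀W (≺⇒Cyc (≺-trans z≺w w≺v₀) v₀≺z'))
      ... | inj₂ (inj₁ v₀≡z') = v₀≡z'
      ... | inj₂ (inj₂ z'≺v₀) = ⊥-elim (proj₂ (W-other z'W z'≢a) (u₀ , v₀ , u₀—v₀ , l≼u₀ , ≺-trans u₀≺w w≺z' , z'≺v₀ , v₀≼r))

    side-over-gap : ∀ {z z' w} → Consec W z z' → z ≢ a → z' ≢ a → z ≺ w → w ≺ z' → InD D z z'
    side-over-gap {z} {z'} {w} zz' z≢a z'≢a z≺w w≺z'
      with minimal≺ (λ u → ∃ λ v → CutOffBy u v w) (λ u → any? (λ v → CutOffBy? u v w)) (gap-is-cut-off zz' z≢a z'≢a z≺w w≺z')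
    ... | u₀ , (v , cut) , u₀-min with maximal≺ (λ v → CutOffBy u₀ v w) (λ v → CutOffBy? u₀ v w) (v , cut)
    ...   | v₀ , cut₀ , v₀-max = outermost-cut-is-side zz' z≢a z'≢a z≺w w≺z' u₀ v₀ cut₀ u₀-min v₀-max

    side-at-l : Consec ⊤ a l ⊎ InD D a l
    side-at-l = from-fan lFan l≺r
      where
      from-fan : ∀ {x} → InFan x → x ≺ r → Consec ⊤ a x ⊎ InD D a x
      from-fan (inj₁ refl)        _   = inj₁ aa⁺
      from-fan (inj₂ (inj₁ refl)) a⁻≺r = ⊥-elim (a⁻⊀ a⁻≺r)
      from-fan (inj₂ (inj₂ a—x))  _   = inj₂ a—x

    side-at-r : Consec ⊤ r a ⊎ InD D r a
    side-at-r = from-fan rFan l≺r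
      where
      from-fan : ∀ {y} → InFan y → l ≺ y → Consec ⊤ y a ⊎ InD D y a
      from-fan (inj₁ refl)        l≺a⁺ = ⊥-elim (⊀a⁺ l≺a⁺)
      from-fan (inj₂ (inj₁ refl)) _    = inj₁ a⁻a
      from-fan (inj₂ (inj₂ a—y))  _    = inj₂ (InD-sym a—y)

    side-away-from-a : ∀ {z z'} → Consec W z z' → z ≢ a → z' ≢ a → Consec ⊤ z z' ⊎ InD D z z'
    side-away-from-a {z} {z'} zz' z≢a z'≢a with any? (λ w → (z ≺? w) ×-dec (w ≺? z'))
    ... | yes (w , z≺w , w≺z') = inj₂ (side-over-gap zz' z≢a z'≢a z≺w w≺z')
    ... | no nothing-between = inj₁ (∈⊤ , ∈⊤ , ≺⇒≢ z≺z' , nothing-between-in-P)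
      where
      z≺z' : z ≺ z'
      z≺z' with trichotomy z≢a z'≢a
      ... | inj₁ z≺z'        = z≺z'
      ... | inj₂ (inj₁ z≡z') = ⊥-elim (proj₁ (proj₂ (proj₂ zz')) z≡z')
      ... | inj₂ (inj₂ z'≺z) = ⊥-elim (proj₂ (proj₂ (proj₂ zz')) a aW (≻⇒Cyc-through-a z'≺z))
      nothing-between-in-P : ∀ w → w ∈ ⊤ → ¬ Cyc z w z'
      nothing-between-in-P w _ c with w ≟ a
      ... | yes refl = ≺-asym z≺z' (Cyc-through-a c)
      ... | no w≢a = nothing-between (w , Cyc⇒≺ c w≢a z≺z')

    sides : ∀ z z' → Consec W z z' → Consec ⊤ z z' ⊎ InD D z z'
    sides z z' zz' with z ≟ a
    ... | yes refl with successor-unique zz' al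
    ...   | refl = side-at-l
    sides z z' zz' | no z≢a with z' ≟ a
    ... | yes refl with predecessor-unique zz' ra
    ...   | refl = side-at-r
    sides z z' zz' | no z≢a | no z'≢a = side-away-from-a zz' z≢a z'≢a

    diagonal-is-side : ∀ {u v} → InD D u v → u ∈ W → v ∈ W → u ≺ v → Consec W u v
    diagonal-is-side {u} {v} u—v uW vW u≺v = uW , vW , ≺⇒≢ u≺v , nothing-between
      where
      nothing-between : ∀ w → w ∈ W → ¬ Cyc u w v
      nothing-between w wW c with w ≟ a
      ... | yes refl = ≺-asym u≺v (Cyc-through-a c)
      ... | no w≢a with Cyc⇒≺ c w≢a u≺v
      ...   | u≺w , w≺v = proj₂ (W-other wW w≢a)
                            (u , v , u—v , proj₁ (proj₁ (W-other uW (≺⇒≢aˡ u≺v))) , u≺w , w≺v ,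
                             proj₂ (proj₁ (W-other vW (≺⇒≢aʳ u≺v))))

    diagonals : ∀ z z' → InD D z z' → z ∈ W → z' ∈ W → Consec W z z' ⊎ Consec W z' z
    diagonals z z' z—z' zW z'W with z ≟ a
    ... | yes refl with W-other z'W (λ e → InD⇒≢ z—z' (sym e))
    ...   | (l≼z' , z'≼r) , _ with fan-in-arc (inj₂ (inj₂ z—z')) l≼z' z'≼r
    ...     | inj₁ refl = inj₁ al
    ...     | inj₂ refl = inj₂ ra
    diagonals z z' z—z' zW z'W | no z≢a with z' ≟ a
    ... | yes refl with W-other zW z≢a
    ...   | (l≼z , z≼r) , _ with fan-in-arc (inj₂ (inj₂ (InD-sym z—z'))) l≼z z≼r
    ...     | inj₁ refl = inj₂ al
    ...     | inj₂ refl = inj₁ ra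
    diagonals z z' z—z' zW z'W | no z≢a | no z'≢a with trichotomy z≢a z'≢a
    ... | inj₁ z≺z'        = inj₁ (diagonal-is-side z—z' zW z'W z≺z')
    ... | inj₂ (inj₁ z≡z') = ⊥-elim (InD⇒≢ z—z' z≡z')
    ... | inj₂ (inj₂ z'≺z) = inj₂ (diagonal-is-side (InD-sym z—z') z'W zW z'≺z)

    isSubpolygon : IsSubpolygon D W
    isSubpolygon = three-vertices , sides , diagonals

  with-successor : ∀ {x} → InFan x → x ≢ a⁻ → ∃ λ W → IsSubpolygon D W × Consec W a x
  with-successor {x} xFan x≢a⁻
    with minimal≺ (λ m → InFan m × x ≺ m) (λ m → InFan? m ×-dec (x ≺? m))
                  (a⁻ , inj₂ (inj₁ refl) , a⁻-greatest (InFan⇒≢a xFan) x≢a⁻)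
  ... | y , (yFan , x≺y) , next = S.W , S.isSubpolygon , S.al
    where module S = Spanned x y xFan yFan (x≺y , λ m mFan (x≺m , m≺y) → next m (mFan , x≺m) m≺y)

  with-predecessor : ∀ {y} → InFan y → y ≢ a⁺ → ∃ λ W → IsSubpolygon D W × Consec W y a
  with-predecessor {y} yFan y≢a⁺
    with maximal≺ (λ m → InFan m × m ≺ y) (λ m → InFan? m ×-dec (m ≺? y))
                  (a⁺ , inj₁ refl , a⁺-least (InFan⇒≢a yFan) y≢a⁺)
  ... | x , (xFan , x≺y) , previous = S.W , S.isSubpolygon , S.ra
    where module S = Spanned x y xFan yFan (x≺y , λ m mFan (x≺m , m≺y) → previous m (mFan , m≺y) x≺m)

module EnumeratedFan {n s : ℕ} (D : List (Fin n × Fin n)) (dis : IsDissection D)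
           (Ws : Fin s → Subset n) (enum : Enumerates D Ws)
           (a a⁻ a⁺ : Fin n) (a⁻a : Consec ⊤ a⁻ a) (aa⁺ : Consec ⊤ a a⁺) where
  open Fan D dis a a⁻ a⁺ a⁻a aa⁺ using (InFan)
  open IncidentSubpolygons D dis a a⁻ a⁺ a⁻a aa⁺ using (unique-by-predecessor; unique-by-successor)
  open WedgeConstruction D dis a a⁻ a⁺ a⁻a aa⁺ using (with-predecessor; with-successor)
  open import Data.Product using (∃; _,_; proj₁; proj₂)
  open import Relation.Binary.PropositionalEquality using (_≡_; _≢_; refl)

  private
    subpolygon : ∀ i → IsSubpolygon D (Ws i)
    subpolygon = proj₁ enum
    injective : ∀ i j → Ws i ≡ Ws j → i ≡ j
    injective = proj₁ (proj₂ enum)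

    index-of : {P : Subset n → Set} → (∃ λ W → IsSubpolygon D W × P W) → ∃ λ i → P (Ws i)
    index-of (W , sW , PW) with proj₂ (proj₂ enum) W sW
    ... | i , refl = i , PW

  predecessor-index : ∀ {x} → InFan x → x ≢ a⁺ → ∃ λ i → Consec (Ws i) x a
  predecessor-index xFan x≢a⁺ = index-of (with-predecessor xFan x≢a⁺)

  predecessor-index-unique : ∀ {x} i j → Consec (Ws i) x a → Consec (Ws j) x a → i ≡ j
  predecessor-index-unique i j xaᵢ xaⱼ =
    injective i j (unique-by-predecessor (subpolygon i) (proj₁ (proj₂ xaᵢ)) (subpolygon j) (proj₁ (proj₂ xaⱼ)) xaᵢ xaⱼ)

  successor-index : ∀ {x} → InFan x → x ≢ a⁻ → ∃ λ i → Consec (Ws i) a x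
  successor-index xFan x≢a⁻ = index-of (with-successor xFan x≢a⁻)

  successor-index-unique : ∀ {x} i j → Consec (Ws i) a x → Consec (Ws j) a x → i ≡ j
  successor-index-unique i j axᵢ axⱼ =
    injective i j (unique-by-successor (subpolygon i) (proj₁ axᵢ) (subpolygon j) (proj₁ axⱼ) axᵢ axⱼ)

module FriezeFacts {c ℓ₁ ℓ₂} (R : CompleteOrderedField c ℓ₁ ℓ₂) {n : ℕ}
                   (f : Fin n → Fin n → CompleteOrderedField.Carrier R) (F : IsFrieze R ⊤ f) where
  open CompleteOrderedField R
  open IsFrieze F
  open import Data.Product using (_,_)
  open import Data.Sum using (_⊎_; inj₁; inj₂)
  open import Function.Bundles using (Equivalence)
  open import Relation.Binary.Reasoning.Setoid setoid

  f-diagonal : ∀ x → f x x ≈ 0#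
  f-diagonal x = Equivalence.from (zero⇔ x x ∈⊤ ∈⊤) ≡.refl

  ptolemy-at-vertex : ∀ {a a⁺ q p} → Consec ⊤ a a⁺ → q ≡ a⁺ ⊎ Cyc a a⁺ q → Cyc a q p →
                      f a q ≈ 1# → f a p ≈ 1# → f a⁺ p ≈ f q p + f a⁺ q
  ptolemy-at-vertex {a} {a⁺} {q} {p} _ (inj₁ ≡.refl) _ _ _ =
    sym (trans (+-congˡ (f-diagonal a⁺)) (+-identityʳ _))
  ptolemy-at-vertex {a} {a⁺} {q} {p} aa⁺ (inj₂ a⁺≺q) q≺p faq≈1 fap≈1 = begin
    f a⁺ p                           ≈⟨ *-identityˡ _ ⟨
    1# * f a⁺ p                      ≈⟨ *-congʳ faq≈1 ⟨
    f a q * f a⁺ p                   ≈⟨ ptolemy a q a⁺ p ∈⊤ ∈⊤ ∈⊤ ∈⊤ (inj₁ (a⁺≺q , q≺p)) ⟩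
    f a a⁺ * f q p + f a p * f a⁺ q  ≈⟨ +-cong (*-congʳ (side a a⁺ aa⁺)) (*-congʳ fap≈1) ⟩
    1# * f q p + 1# * f a⁺ q         ≈⟨ +-cong (*-identityˡ _) (*-identityˡ _) ⟩
    f q p + f a⁺ q                   ∎

module VertexIdentities {c ℓ₁ ℓ₂} (R : CompleteOrderedField c ℓ₁ ℓ₂) {n s : ℕ} (n≥3 : 3 ≤ n)
    (D : List (Fin n × Fin n)) (dis : IsDissection D)
    (Ws : Fin s → Subset n) (enum : Enumerates D Ws)
    (fs : Fin s → Fin n → Fin n → CompleteOrderedField.Carrier R) (fr : ∀ i → IsFrieze R (Ws i) (fs i))
    (f : Fin n → Fin n → CompleteOrderedField.Carrier R) (F : IsFrieze R ⊤ f)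
    (restricts : ∀ i a b → a ∈ Ws i → b ∈ Ws i → CompleteOrderedField._≈_ R (f a b) (fs i a b))
    (cs : Fin s → CompleteOrderedField.Carrier R)
    (constant : ∀ i a′ a a″ → Consec (Ws i) a′ a → Consec (Ws i) a a″ → CompleteOrderedField._≈_ R (fs i a′ a″) (cs i))
    (a⁻ a a⁺ : Fin n) (a⁻a : Consec ⊤ a⁻ a) (aa⁺ : Consec ⊤ a a⁺) where
  open CompleteOrderedField R
  open import Algebra.Properties.CommutativeMonoid.Sum +-commutativeMonoid using (sum)
  open RestrictedSums +-commutativeMonoid
  open FiniteSets using (Consec?)
  open Fan D dis a a⁻ a⁺ a⁻a aa⁺ using (InFan; InFan?; a⁺-first; a⁻≢a⁺; predecessor-unique; successor-unique)
  open IncidentSubpolygons D dis a a⁻ a⁺ a⁻a aa⁺ using (module Wedge)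
  open EnumeratedFan D dis Ws enum a a⁻ a⁺ a⁻a aa⁺
  open FriezeFacts R f F
  open import Data.Bool using (true; false; if_then_else_)
  open import Data.Fin.Properties using (_≟_)
  open import Data.Fin.Subset.Properties using (∈⊤)
  open import Data.Vec using (lookup)
  open import Data.Vec.Properties using ([]=⇒lookup; lookup⇒[]=)
  open import Data.Product using (_,_; proj₁; proj₂)
  open import Data.Sum using (inj₁; inj₂)
  open import Relation.Nullary using (¬_; Dec; yes; no)
  open import Relation.Binary.PropositionalEquality using (_≢_)
  open import Relation.Binary.Reasoning.Setoid setoid

  h : Fin n → Carrier
  h x = f a⁺ x

  Precedes? : ∀ i x → Dec (Consec (Ws i) x a)
  Precedes? i x = Consec? (Ws i) x a

  Follows? : ∀ i x → Dec (Consec (Ws i) a x)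
  Follows? i x = Consec? (Ws i) a x

  incident : Fin s → Carrier
  incident i = if lookup (Ws i) a then cs i else 0#

  wedge-step : ∀ i {q p} → Consec (Ws i) a q → Consec (Ws i) p a → cs i + h q ≈ h p
  wedge-step i {q} {p} aq pa = begin
      cs i + h q   ≈⟨ +-congʳ f-q-p ⟨
      f q p + h q  ≈⟨ ptolemy-at-vertex aa⁺ (a⁺-first E.q≢a) E.q≺p f-a-q f-a-p ⟨
      h p          ∎
    where
    module E = Wedge.Ends (Ws i) (proj₁ enum i) (proj₁ aq) q p aq pa
    module F = IsFrieze F
    module Fᵢ = IsFrieze (fr i)
    f-a-q : f a q ≈ 1#
    f-a-q = trans (restricts i a q (proj₁ aq) E.qV) (Fᵢ.side a q aq)
    f-a-p : f a p ≈ 1#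
    f-a-p = trans (F.symm a p ∈⊤ ∈⊤) (trans (restricts i p a E.pV (proj₁ aq)) (Fᵢ.side p a pa))
    f-q-p : f q p ≈ cs i
    f-q-p = trans (F.symm q p ∈⊤ ∈⊤) (trans (restricts i p q E.pV E.qV) (constant i p a q pa aq))

  wedge-identity : ∀ i → incident i + sum (restrict (Follows? i) h) ≈ sum (restrict (Precedes? i) h)
  wedge-identity i with lookup (Ws i) a in a∈?Wsᵢ
  ... | true =
      let aW = lookup⇒[]= a (Ws i) a∈?Wsᵢ
          (q , aq) = Wedge.successor (Ws i) (proj₁ enum i) aW
          (p , pa) = Wedge.predecessor (Ws i) (proj₁ enum i) aW
      in begin
      cs i + sum (restrict (Follows? i) h)  ≈⟨ +-congˡ (sum-restrict-unique (Follows? i) h (λ _ _ → successor-unique) q aq) ⟩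
      cs i + h q                            ≈⟨ wedge-step i aq pa ⟩
      h p                                   ≈⟨ sum-restrict-unique (Precedes? i) h (λ _ _ → predecessor-unique) p pa ⟨
      sum (restrict (Precedes? i) h)        ∎
  ... | false = begin
      0# + sum (restrict (Follows? i) h)  ≈⟨ +-identityˡ _ ⟩
      sum (restrict (Follows? i) h)       ≈⟨ sum-restrict-none (Follows? i) h (λ x ax → a∉Wsᵢ (proj₁ ax)) ⟩
      0#                                  ≈⟨ sum-restrict-none (Precedes? i) h (λ x xa → a∉Wsᵢ (proj₁ (proj₂ xa))) ⟨
      sum (restrict (Precedes? i) h)      ∎
    where
    a∉Wsᵢ : ¬ a ∈ Ws i
    a∉Wsᵢ a∈ with ≡.trans (≡.sym ([]=⇒lookup a∈)) a∈?Wsᵢ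
    ... | ()

  precedes-count : Fin n → Carrier
  precedes-count x = sum (restrict (λ i → Precedes? i x) (λ _ → h x))

  follows-count : Fin n → Carrier
  follows-count x = sum (restrict (λ i → Follows? i x) (λ _ → h x))

  precedes-count-fan : ∀ {x} → InFan x → x ≢ a⁺ → precedes-count x ≈ h x
  precedes-count-fan {x} xFan x≢a⁺ =
    let (i , xa) = predecessor-index xFan x≢a⁺
    in  sum-restrict-unique (λ i → Precedes? i x) (λ _ → h x) predecessor-index-unique i xa

  precedes-count-other : ∀ {x} → ¬ (InFan x × x ≢ a⁺) → precedes-count x ≈ 0#
  precedes-count-other {x} not-fan = sum-restrict-none (λ i → Precedes? i x) (λ _ → h x) λ i xa →
    not-fan (Wedge.predecessor-inFan (Ws i) (proj₁ enum i) (proj₁ (proj₂ xa)) xa)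

  follows-count-fan : ∀ {x} → InFan x → x ≢ a⁻ → follows-count x ≈ h x
  follows-count-fan {x} xFan x≢a⁻ =
    let (i , ax) = successor-index xFan x≢a⁻
    in  sum-restrict-unique (λ i → Follows? i x) (λ _ → h x) successor-index-unique i ax

  follows-count-other : ∀ {x} → ¬ (InFan x × x ≢ a⁻) → follows-count x ≈ 0#
  follows-count-other {x} not-fan = sum-restrict-none (λ i → Follows? i x) (λ _ → h x) λ i ax →
    not-fan (Wedge.successor-inFan (Ws i) (proj₁ enum i) (proj₁ ax) ax)

  -- Each fan vertex other than a⁺, a⁻ is counted once on either side; a⁻ only as a
  -- predecessor and a⁺ only as a successor, where it contributes h(a⁺) = f(a⁺,a⁺) = 0.
  fan-identity : ∀ x → precedes-count x ≈ restrict (_≟ a⁻) h x + follows-count x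
  fan-identity x with x ≟ a⁻
  ... | yes ≡.refl = sym (trans (+-congˡ (follows-count-other (λ (_ , x≢a⁻) → x≢a⁻ ≡.refl))) (trans (+-identityʳ _)
                       (sym (precedes-count-fan (inj₂ (inj₁ ≡.refl)) (a⁻≢a⁺ n≥3)))))
  ... | no x≢a⁻ with InFan? x
  ...   | no not-fan = trans (precedes-count-other (λ (xFan , _) → not-fan xFan))
                         (sym (trans (+-identityˡ _) (follows-count-other (λ (xFan , _) → not-fan xFan))))
  ...   | yes xFan with x ≟ a⁺
  ...     | no x≢a⁺ = trans (precedes-count-fan xFan x≢a⁺) (sym (trans (+-identityˡ _) (follows-count-fan xFan x≢a⁻)))
  ...     | yes ≡.refl = begin
      precedes-count a⁺   ≈⟨ precedes-count-other (λ (_ , a⁺≢a⁺) → a⁺≢a⁺ ≡.refl) ⟩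
      0#                  ≈⟨ f-diagonal a⁺ ⟨
      h a⁺                ≈⟨ follows-count-fan xFan x≢a⁻ ⟨
      follows-count a⁺    ≈⟨ +-identityˡ _ ⟨
      0# + follows-count a⁺ ∎

sumFin≡sum : ∀ {c ℓ₁ ℓ₂} (R : CompleteOrderedField c ℓ₁ ℓ₂) {s : ℕ} (g : Fin s → CompleteOrderedField.Carrier R) →
             sumFin R g ≡ Algebra.Properties.CommutativeMonoid.Sum.sum (CompleteOrderedField.+-commutativeMonoid R) g
sumFin≡sum R {ℕ.zero}  g = ≡.refl
sumFin≡sum R {ℕ.suc s} g = ≡.cong (g Fin.zero +_) (sumFin≡sum R (λ i → g (Fin.suc i)))
  where open CompleteOrderedField R using (_+_)

lemma3p4 : ∀ {c ℓ₁ ℓ₂} (R : CompleteOrderedField c ℓ₁ ℓ₂) →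
    (n : ℕ) → 3 ≤ n →
    let open CompleteOrderedField R in
    (D : List (Fin n × Fin n)) → IsDissection D →
    (s : ℕ) (Ws : Fin s → Subset n) → Enumerates D Ws →
    (fs : Fin s → Fin n → Fin n → Carrier) → (∀ i → IsFrieze R (Ws i) (fs i)) →
    (f : Fin n → Fin n → Carrier) → IsFrieze R ⊤ f →
    (∀ i a b → a ∈ Ws i → b ∈ Ws i → f a b ≈ fs i a b) →
    (cs : Fin s → Carrier) →
    (∀ i a′ a a″ → Consec (Ws i) a′ a → Consec (Ws i) a a″ → fs i a′ a″ ≈ cs i) →
    ∀ a⁻ a a⁺ → Consec ⊤ a⁻ a → Consec ⊤ a a⁺ →
    f a⁻ a⁺ ≈ incidentSum R Ws cs a
lemma3p4 R n n≥3 D dis s Ws enum fs fr f F restricts cs constant a⁻ a a⁺ a⁻a aa⁺ = begin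
    f a⁻ a⁺                ≈⟨ IsFrieze.symm F a⁻ a⁺ ∈⊤ ∈⊤ ⟩
    h a⁻                   ≈⟨ ∙-cancelʳ (sum follows) _ _ telescoping ⟨
    sum incident           ≡⟨ sumFin≡sum R incident ⟨
    incidentSum R Ws cs a  ∎
  where
  open CompleteOrderedField R
  open Algebra.Properties.CommutativeMonoid.Sum +-commutativeMonoid using (sum; ∑-comm; ∑-distrib-+; sum-cong-≋)
  open RestrictedSums +-commutativeMonoid using (restrict; sum-restrict-unique)
  open VertexIdentities R n≥3 D dis Ws enum fs fr f F restricts cs constant a⁻ a a⁺ a⁻a aa⁺
  open Algebra.Properties.Group +-group using (∙-cancelʳ)
  open Relation.Binary.Reasoning.Setoid setoid

  follows : Fin s → Carrier
  follows i = sum (restrict (Follows? i) h)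

  -- summing the wedge identities over i and the fan identities over x, both sides
  -- count the same terms h(x), except for the term h(a⁻)
  telescoping : sum incident + sum follows ≈ h a⁻ + sum follows
  telescoping = begin
    sum incident + sum follows                               ≈⟨ ∑-distrib-+ incident follows ⟨
    sum (λ i → incident i + follows i)                       ≈⟨ sum-cong-≋ wedge-identity ⟩
    sum (λ i → sum (restrict (Precedes? i) h))               ≈⟨ ∑-comm (λ i → restrict (Precedes? i) h) ⟩
    sum precedes-count                                       ≈⟨ sum-cong-≋ fan-identity ⟩
    sum (λ x → restrict (_≟ a⁻) h x + follows-count x)       ≈⟨ ∑-distrib-+ (restrict (_≟ a⁻) h) follows-count ⟩
    sum (restrict (_≟ a⁻) h) + sum follows-count             ≈⟨ +-cong (sum-restrict-unique (_≟ a⁻) h (λ _ _ x≡a⁻ y≡a⁻ → ≡.trans x≡a⁻ (≡.sym y≡a⁻)) a⁻ ≡.refl)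
                                                                        (sym (∑-comm (λ i → restrict (Follows? i) h))) ⟩
    h a⁻ + sum follows                                       ∎
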